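{- Fix any $M(t), N(t)\in \widehat{A[t]}$. For any $X\in A$, there exists unique $U(t)\in \widehat{A[t]}$ and unique $X'\in A$ such that \[(X + I_n t + p I_n t^2 M(t))\, U(t) = X' + I_n t + pI_n t^2 N(t).\] Moreover, we have $U(t)\in I_n + p \widehat{A[t]}$ and $X'\equiv X\pmod p$.
   Context: Let $p$ be a prime, fix $n \in \mathbb{Z}_{\geq 1}$, and let $A := \mathrm{M}_n(\mathbb{Z}_p)$ be the (noncommutative for $n\geq 2$) ring of $n\times n$ matrices over the $p$-adic integers, with $I_n$ the identity matrix. Let $A[t]$ and $A[[t]]$ denote the polynomial ring and the formal power series ring over $A$ in a variable $t$ that commutes with $A$, topologized via the product topology induced from the $p$-adic topology on $A$. Define $\widehat{A[t]}$ to be the subring of $A[[t]]$ given by \[\widehat{A[t]} := \Big\{\sum_{l=0}^{\infty}C_l t^l : C_l \in A \text{ and } \lim_{l \to \infty} C_l=0 \text{ ($p$-adically)}\Big\},\] with the subspace topology. -}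

module Defs where

open import Data.Nat using (ℕ; zero; suc; _≤_; _∸_; _^_)
open import Data.Integer using (ℤ; +_; _+_; _-_; _*_)
open import Data.Integer.Divisibility using (_∣_)
open import Data.Fin using (Fin)
open import Relation.Nullary using (yes; no)
import Data.Fin as Fin
open import Data.Product using (Σ; _×_; ∃)

_≡_[mod_] : ℤ → ℤ → ℕ → Set
a ≡ b [mod m ] = (+ m) ∣ (a - b)

-- p-adic integers as the inverse limit lim Z/p^k: a p-adic integer is
-- represented by a sequence x with x k a representative of its class mod p^k.
-- Ring operations are computed levelwise (on raw sequences); equality is
-- levelwise congruence mod p^k.
Zs : Set
Zs = ℕ → ℤ

IsZp : ℕ → Zs → Set
IsZp p x = ∀ k → x (suc k) ≡ x k [mod p ^ k ]

_≈[_]_ : Zs → ℕ → Zs → Set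
x ≈[ p ] y = ∀ k → x k ≡ y k [mod p ^ k ]

zs0 zs1 : Zs
zs0 _ = + 0
zs1 _ = + 1

zsNat : ℕ → Zs
zsNat m _ = + m

_+s_ _*s_ : Zs → Zs → Zs
(x +s y) k = x k + y k
(x *s y) k = x k * y k

Mat : ℕ → Set
Mat n = Fin n → Fin n → Zs

IsMat : ℕ → (n : ℕ) → Mat n → Set
IsMat p n X = ∀ i j → IsZp p (X i j)

_≈M[_]_ : {n : ℕ} → Mat n → ℕ → Mat n → Set
X ≈M[ p ] Y = ∀ i j → X i j ≈[ p ] Y i j

0M IM : {n : ℕ} → Mat n
0M i j = zs0
IM i j with i Fin.≟ j
... | yes _ = zs1
... | no _ = zs0

_+M_ : {n : ℕ} → Mat n → Mat n → Mat n
(X +M Y) i j = X i j +s Y i j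

_·M_ : {n : ℕ} → ℕ → Mat n → Mat n
(c ·M X) i j = zsNat c *s X i j

sumFin : (n : ℕ) → (Fin n → Zs) → Zs
sumFin zero f = zs0
sumFin (suc n) f = f Fin.zero +s sumFin n (λ i → f (Fin.suc i))

_*M_ : {n : ℕ} → Mat n → Mat n → Mat n
_*M_ {n} X Y i j = sumFin n (λ m → X i m *s Y m j)

Series : ℕ → Set
Series n = ℕ → Mat n

-- membership in the restricted power series ring: coefficients in A and
-- C_l → 0 p-adically, i.e. for every k, eventually C_l ∈ p^k A
-- (for a coherent x, x ∈ p^k Z_p iff x k ≡ 0 mod p^k).
IsRestricted : ℕ → (n : ℕ) → Series n → Set
IsRestricted p n C =
  (∀ l → IsMat p n (C l)) ×
  (∀ k → ∃ λ L → ∀ l → L ≤ l → ∀ i j → C l i j k ≡ + 0 [mod p ^ k ])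

_≈S[_]_ : {n : ℕ} → Series n → ℕ → Series n → Set
F ≈S[ p ] G = ∀ l → F l ≈M[ p ] G l

constS : {n : ℕ} → Mat n → Series n
constS X zero = X
constS X (suc l) = 0M

shiftS : {n : ℕ} → Series n → Series n
shiftS F zero = 0M
shiftS F (suc l) = F l

_+S_ : {n : ℕ} → Series n → Series n → Series n
(F +S G) l = F l +M G l

_·S_ : {n : ℕ} → ℕ → Series n → Series n
(c ·S F) l = c ·M F l

sumUpTo : {n : ℕ} → (ℕ → Mat n) → ℕ → Mat n
sumUpTo f zero = f zero
sumUpTo f (suc l) = sumUpTo f l +M f (suc l)

-- Cauchy product (t commutes with A): (F G)_l = Σ_{j ≤ l} F_j G_{l-j}
_*S_ : {n : ℕ} → Series n → Series n → Series n
(F *S G) l = sumUpTo (λ j → F j *M G (l ∸ j)) l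

wpoly : (p : ℕ) {n : ℕ} → Mat n → Series n → Series n
wpoly p X M = constS X +S (shiftS (constS IM) +S (p ·S shiftS (shiftS M)))

-- Work at a fixed precision level k, i.e. over ℤ/p^k, where the restricted series M, N and the
-- unknown U have finite support. There the equation in positive degrees reads
-- X U_{l+1} + U_l + p (M U)_{l-1} = (I t + p t² N)_{l+1}. It is solved modulo p, p², …, p^k in turn:
-- since the p (M U) term of a correction D ≡ 0 (mod p^e) vanishes modulo p^(e+1), the correction only
-- has to satisfy X D_{l+1} + D_l = error_{l+1}, which back substitution solves because the error has
-- finite support. The same recurrence, run downwards from the vanishing tail, shows uniqueness; so the
-- solutions at the various levels are coherent and glue to a p-adic U, and X′ is forced to be X U_0.
-- Finally I solves the equation modulo p, hence U ≡ I and X′ = X U_0 ≡ X (mod p).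

module Submission where

open import Defs
open import Data.Nat as ℕ using (ℕ; zero; suc; _≤_; _∸_; _^_; z≤n; s≤s)
import Data.Nat.Properties as ℕP
import Data.Nat.Divisibility as ℕD
open import Data.Nat.Primality using (Prime; prime⇒nonZero)
open import Data.Integer using (ℤ; +_; _+_; _-_; _*_; -_)
import Data.Integer.Properties as ℤP
open import Data.Integer.Divisibility.Signed as S using (divides)
open import Data.Integer.Tactic.RingSolver using (solve-∀)
open import Data.Fin as Fin using (Fin)
open import Data.Product using (Σ; _×_; _,_; proj₁; proj₂)
open import Relation.Nullary using (yes; no; contradiction)
open import Relation.Binary.PropositionalEquality
  using (_≡_; refl; sym; trans; cong; subst)

infix 4 _≡_⟨mod_⟩

-- Signed divisibility in a record, so that a and b can be inferred from the type.
record _≡_⟨mod_⟩ (a b : ℤ) (q : ℕ) : Set where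
  constructor mod
  field divides-diff : (+ q) S.∣ (a - b)
open _≡_⟨mod_⟩ public

module _ {q : ℕ} where

  private
    lift : ∀ {x y} → x ≡ y → (+ q) S.∣ x → (+ q) S.∣ y
    lift = subst ((+ q) S.∣_)

  ≡⇒≡-mod : ∀ {a b} → a ≡ b → a ≡ b ⟨mod q ⟩
  ≡⇒≡-mod {a} refl = mod (lift (solve a) (divides (+ 0) refl))
    where solve : ∀ a → + 0 ≡ a - a
          solve = solve-∀

  ≡-mod-refl : ∀ {a} → a ≡ a ⟨mod q ⟩
  ≡-mod-refl = ≡⇒≡-mod refl

  ≡-mod-sym : ∀ {a b} → a ≡ b ⟨mod q ⟩ → b ≡ a ⟨mod q ⟩
  ≡-mod-sym {a} {b} (mod h) = mod (lift (solve a b) (S.∣m⇒∣-m h))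
    where solve : ∀ a b → - (a - b) ≡ b - a
          solve = solve-∀

  ≡-mod-trans : ∀ {a b c} → a ≡ b ⟨mod q ⟩ → b ≡ c ⟨mod q ⟩ → a ≡ c ⟨mod q ⟩
  ≡-mod-trans {a} {b} {c} (mod h) (mod g) = mod (lift (solve a b c) (S.∣m∣n⇒∣m+n h g))
    where solve : ∀ a b c → (a - b) + (b - c) ≡ a - c
          solve = solve-∀

  +-cong-mod : ∀ {a b c d} → a ≡ c ⟨mod q ⟩ → b ≡ d ⟨mod q ⟩ → a + b ≡ c + d ⟨mod q ⟩
  +-cong-mod {a} {b} {c} {d} (mod h) (mod g) = mod (lift (solve a b c d) (S.∣m∣n⇒∣m+n h g))
    where solve : ∀ a b c d → (a - c) + (b - d) ≡ (a + b) - (c + d)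
          solve = solve-∀

  neg-cong-mod : ∀ {a b} → a ≡ b ⟨mod q ⟩ → - a ≡ - b ⟨mod q ⟩
  neg-cong-mod {a} {b} (mod h) = mod (lift (solve a b) (S.∣m⇒∣-m h))
    where solve : ∀ a b → - (a - b) ≡ (- a) - (- b)
          solve = solve-∀

  sub-cong-mod : ∀ {a b c d} → a ≡ c ⟨mod q ⟩ → b ≡ d ⟨mod q ⟩ → a - b ≡ c - d ⟨mod q ⟩
  sub-cong-mod h g = +-cong-mod h (neg-cong-mod g)

  *-cong-mod : ∀ {a b c d} → a ≡ c ⟨mod q ⟩ → b ≡ d ⟨mod q ⟩ → a * b ≡ c * d ⟨mod q ⟩
  *-cong-mod {a} {b} {c} {d} (mod h) (mod g) =
    mod (lift (solve a b c d) (S.∣m∣n⇒∣m+n (S.∣n⇒∣m*n a g) (S.∣m⇒∣m*n d h)))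
    where solve : ∀ a b c d → a * (b - d) + (a - c) * d ≡ a * b - c * d
          solve = solve-∀

  +-cancelˡ-mod : ∀ {a b c d} → a + b ≡ c + d ⟨mod q ⟩ → a ≡ c ⟨mod q ⟩ → b ≡ d ⟨mod q ⟩
  +-cancelˡ-mod {a} {b} {c} {d} h g =
    ≡-mod-trans (≡⇒≡-mod (solve a b)) (≡-mod-trans (sub-cong-mod h g) (≡⇒≡-mod (sym (solve c d))))
    where solve : ∀ a b → b ≡ (a + b) - a
          solve = solve-∀

  +-cancelʳ-mod : ∀ {a b c d} → a + b ≡ c + d ⟨mod q ⟩ → b ≡ d ⟨mod q ⟩ → a ≡ c ⟨mod q ⟩
  +-cancelʳ-mod {a} {b} {c} {d} h g =
    +-cancelˡ-mod (≡-mod-trans (≡⇒≡-mod (ℤP.+-comm b a)) (≡-mod-trans h (≡⇒≡-mod (ℤP.+-comm c d)))) g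

  ≡-mod⇒[mod] : ∀ {a b} → a ≡ b ⟨mod q ⟩ → a ≡ b [mod q ]
  ≡-mod⇒[mod] (mod h) = S.∣⇒∣ᵤ h

  [mod]⇒≡-mod : ∀ {a b} → a ≡ b [mod q ] → a ≡ b ⟨mod q ⟩
  [mod]⇒≡-mod h = mod (S.∣ᵤ⇒∣ h)

≡-mod-1 : ∀ {a b} → a ≡ b ⟨mod 1 ⟩
≡-mod-1 {a} {b} = mod (divides (a - b) (sym (ℤP.*-identityʳ (a - b))))

≡-mod-weaken : ∀ {q q′ a b} → q ℕD.∣ q′ → a ≡ b ⟨mod q′ ⟩ → a ≡ b ⟨mod q ⟩
≡-mod-weaken d (mod h) = mod (S.∣-trans (S.∣ᵤ⇒∣ d) h)

+-sub-cancel : ∀ a b → a + (b - a) ≡ b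
+-sub-cancel = solve-∀

*-distribˡ-minus : ∀ c a b → c * (a - b) ≡ c * a - c * b
*-distribˡ-minus = solve-∀

*-cong-mod-scale : ∀ {q a b} c → a ≡ b ⟨mod q ⟩ → + c * a ≡ + c * b ⟨mod c ℕ.* q ⟩
*-cong-mod-scale {q} {a} {b} c (mod h) =
  mod (subst (S._∣ (+ c * a - + c * b)) (sym (ℤP.pos-* c q))
        (subst ((+ c * + q) S.∣_) (*-distribˡ-minus (+ c) a b) (S.*-monoʳ-∣ (+ c) h)))

*-cancel-mod-scale : ∀ {q a b} c .{{_ : ℕ.NonZero c}} →
  + c * a ≡ + c * b ⟨mod c ℕ.* q ⟩ → a ≡ b ⟨mod q ⟩
*-cancel-mod-scale {q} {a} {b} c (mod h) =
  mod (S.*-cancelˡ-∣ (+ c)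
    (subst (S._∣ (+ c * (a - b))) (ℤP.pos-* c q)
      (subst ((+ (c ℕ.* q)) S.∣_) (sym (*-distribˡ-minus (+ c) a b)) h)))

^-monoʳ-∣ : ∀ p {a b} → a ≤ b → (p ^ a) ℕD.∣ (p ^ b)
^-monoʳ-∣ p {b = b} z≤n = ℕD.1∣ (p ^ b)
^-monoʳ-∣ p (s≤s le) = ℕD.*-monoʳ-∣ p (^-monoʳ-∣ p le)

module _ {q : ℕ} where

  sumFin-cong : ∀ m (f g : Fin m → Zs) {k₁ k₂} → (∀ i → f i k₁ ≡ g i k₂ ⟨mod q ⟩) →
    sumFin m f k₁ ≡ sumFin m g k₂ ⟨mod q ⟩
  sumFin-cong zero    f g h = ≡-mod-refl
  sumFin-cong (suc m) f g h =
    +-cong-mod (h Fin.zero) (sumFin-cong m (λ i → f (Fin.suc i)) (λ i → g (Fin.suc i)) (λ i → h (Fin.suc i)))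

  sumFin-zero : ∀ m (f : Fin m → Zs) {k} → (∀ i → f i k ≡ + 0 ⟨mod q ⟩) → sumFin m f k ≡ + 0 ⟨mod q ⟩
  sumFin-zero zero    f h = ≡-mod-refl
  sumFin-zero (suc m) f h = +-cong-mod (h Fin.zero) (sumFin-zero m (λ i → f (Fin.suc i)) (λ i → h (Fin.suc i)))

sumFin-+ : ∀ m (f g : Fin m → Zs) k → sumFin m (λ i → f i +s g i) k ≡ sumFin m f k + sumFin m g k
sumFin-+ zero    f g k = refl
sumFin-+ (suc m) f g k = trans (cong (λ s → f Fin.zero k + g Fin.zero k + s) (sumFin-+ m (λ i → f (Fin.suc i)) (λ i → g (Fin.suc i)) k))
                               (solve (f Fin.zero k) (g Fin.zero k) _ _)
  where solve : ∀ a b c d → (a + b) + (c + d) ≡ (a + c) + (b + d)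
        solve = solve-∀

sumFin-*ˡ : ∀ m c (f : Fin m → Zs) k → sumFin m (λ i → (λ _ → c) *s f i) k ≡ c * sumFin m f k
sumFin-*ˡ zero    c f k = sym (ℤP.*-zeroʳ c)
sumFin-*ˡ (suc m) c f k = trans (cong (λ s → c * f Fin.zero k + s) (sumFin-*ˡ m c (λ i → f (Fin.suc i)) k))
                                (sym (ℤP.*-distribˡ-+ c (f Fin.zero k) _))

IM-suc : ∀ {m} (i j : Fin m) → IM {suc m} (Fin.suc i) (Fin.suc j) ≡ IM i j
IM-suc i j with i Fin.≟ j
... | yes _ = refl
... | no _  = refl

IM-sym : ∀ {m} (i j : Fin m) → IM i j ≡ IM j i
IM-sym i j with i Fin.≟ j | j Fin.≟ i
... | yes _ | yes _ = refl
... | no _  | no _  = refl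
... | yes e | no ne = contradiction (sym e) ne
... | no ne | yes e = contradiction (sym e) ne

IM-level : ∀ {m} (i j : Fin m) k₁ k₂ → IM i j k₁ ≡ IM i j k₂
IM-level i j k₁ k₂ with i Fin.≟ j
... | yes _ = refl
... | no _  = refl

module _ {q : ℕ} where

  sumFin-IMˡ : ∀ m (i : Fin m) (G : Fin m → Zs) {k} → sumFin m (λ r → IM i r *s G r) k ≡ G i k ⟨mod q ⟩
  sumFin-IMˡ (suc m) Fin.zero G {k} = ≡-mod-trans
    (+-cong-mod (≡-mod-refl {a = + 1 * G Fin.zero k})
                (sumFin-zero m (λ r → IM Fin.zero (Fin.suc r) *s G (Fin.suc r)) (λ r → ≡-mod-refl)))
    (≡⇒≡-mod (trans (ℤP.+-identityʳ _) (ℤP.*-identityˡ _)))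
  sumFin-IMˡ (suc m) (Fin.suc i) G {k} = ≡-mod-trans
    (+-cong-mod (≡-mod-refl {a = + 0 * G Fin.zero k})
      (≡-mod-trans
        (sumFin-cong m (λ r → IM (Fin.suc i) (Fin.suc r) *s G (Fin.suc r)) (λ r → IM i r *s G (Fin.suc r))
          (λ r → ≡⇒≡-mod (cong (λ z → z k * G (Fin.suc r) k) (IM-suc i r))))
        (sumFin-IMˡ m i (λ r → G (Fin.suc r)))))
    (≡⇒≡-mod (ℤP.+-identityˡ _))

  sumFin-IMʳ : ∀ m (j : Fin m) (G : Fin m → Zs) {k} → sumFin m (λ r → G r *s IM r j) k ≡ G j k ⟨mod q ⟩
  sumFin-IMʳ m j G {k} = ≡-mod-trans
    (sumFin-cong m (λ r → G r *s IM r j) (λ r → IM j r *s G r)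
      (λ r → ≡⇒≡-mod (trans (ℤP.*-comm (G r k) (IM r j k)) (cong (λ z → z k * G r k) (IM-sym r j)))))
    (sumFin-IMˡ m j G)

module _ {n : ℕ} where

  -- Entrywise congruence of A taken at precision level k₁ with B taken at level k₂; comparing a
  -- matrix with itself at levels k + 1 and k expresses coherence.
  record MatEq (q k₁ k₂ : ℕ) (A B : Mat n) : Set where
    constructor matEq
    field entry : ∀ i j → A i j k₁ ≡ B i j k₂ ⟨mod q ⟩
  open MatEq public

  MatZero : (q k : ℕ) → Mat n → Set
  MatZero q k A = MatEq q k k A 0M

  module _ {q : ℕ} where

    matEq-refl : ∀ {k A} → MatEq q k k A A
    matEq-refl = matEq λ i j → ≡-mod-refl

    matEq-sym : ∀ {k₁ k₂ A B} → MatEq q k₁ k₂ A B → MatEq q k₂ k₁ B A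
    matEq-sym h = matEq λ i j → ≡-mod-sym (entry h i j)

    matEq-trans : ∀ {k₁ k₂ k₃ A B C} → MatEq q k₁ k₂ A B → MatEq q k₂ k₃ B C → MatEq q k₁ k₃ A C
    matEq-trans h g = matEq λ i j → ≡-mod-trans (entry h i j) (entry g i j)

    matZero-matEq : ∀ {k₁ k₂ A B} → MatZero q k₁ A → MatZero q k₂ B → MatEq q k₁ k₂ A B
    matZero-matEq h g = matEq λ i j → ≡-mod-trans (entry h i j) (≡-mod-sym (entry g i j))

    +M-cong : ∀ {k₁ k₂ A B C D} → MatEq q k₁ k₂ A C → MatEq q k₁ k₂ B D → MatEq q k₁ k₂ (A +M B) (C +M D)
    +M-cong h g = matEq λ i j → +-cong-mod (entry h i j) (entry g i j)

    *M-cong : ∀ {k₁ k₂ A A′ B B′} → MatEq q k₁ k₂ A A′ → MatEq q k₁ k₂ B B′ → MatEq q k₁ k₂ (A *M B) (A′ *M B′)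
    *M-cong {A = A} {A′} {B} {B′} h g = matEq λ i j →
      sumFin-cong n (λ m → A i m *s B m j) (λ m → A′ i m *s B′ m j) (λ m → *-cong-mod (entry h i m) (entry g m j))

    *M-distribˡ-+M : ∀ {k} A B C → MatEq q k k (A *M (B +M C)) ((A *M B) +M (A *M C))
    *M-distribˡ-+M {k} A B C = matEq λ i j → ≡-mod-trans
      (sumFin-cong n (λ m → A i m *s (B m j +s C m j)) (λ m → (A i m *s B m j) +s (A i m *s C m j))
        (λ m → ≡⇒≡-mod (ℤP.*-distribˡ-+ (A i m k) (B m j k) (C m j k))))
      (≡⇒≡-mod (sumFin-+ n (λ m → A i m *s B m j) (λ m → A i m *s C m j) k))

    ·M-*M-assoc : ∀ {k} c A B → MatEq q k k ((c ·M A) *M B) (c ·M (A *M B))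
    ·M-*M-assoc {k} c A B = matEq λ i j → ≡-mod-trans
      (sumFin-cong n (λ m → (zsNat c *s A i m) *s B m j) (λ m → zsNat c *s (A i m *s B m j))
        (λ m → ≡⇒≡-mod (ℤP.*-assoc (+ c) (A i m k) (B m j k))))
      (≡⇒≡-mod (sumFin-*ˡ n (+ c) (λ m → A i m *s B m j) k))

    *M-zeroˡ : ∀ {k A} B → MatZero q k A → MatZero q k (A *M B)
    *M-zeroˡ {k} {A} B h = matEq λ i j →
      sumFin-zero n (λ m → A i m *s B m j) (λ m → *-cong-mod (entry h i m) (≡-mod-refl {a = B m j k}))

    *M-zeroʳ : ∀ {k} A {B} → MatZero q k B → MatZero q k (A *M B)
    *M-zeroʳ {k} A {B} h = matEq λ i j → sumFin-zero n (λ m → A i m *s B m j)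
      (λ m → ≡-mod-trans (*-cong-mod (≡-mod-refl {a = A i m k}) (entry h m j)) (≡⇒≡-mod (ℤP.*-zeroʳ (A i m k))))

    *M-identityˡ : ∀ {k} A → MatEq q k k (IM *M A) A
    *M-identityˡ A = matEq λ i j → sumFin-IMˡ n i (λ r → A r j)

    *M-identityʳ : ∀ {k} A → MatEq q k k (A *M IM) A
    *M-identityʳ A = matEq λ i j → sumFin-IMʳ n j (λ r → A i r)

    +M-cancelˡ : ∀ {k₁ k₂ A B C D} → MatEq q k₁ k₂ (A +M B) (C +M D) → MatEq q k₁ k₂ A C → MatEq q k₁ k₂ B D
    +M-cancelˡ h g = matEq λ i j → +-cancelˡ-mod (entry h i j) (entry g i j)

    +M-cancelʳ : ∀ {k₁ k₂ A B C D} → MatEq q k₁ k₂ (A +M B) (C +M D) → MatEq q k₁ k₂ B D → MatEq q k₁ k₂ A C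
    +M-cancelʳ h g = matEq λ i j → +-cancelʳ-mod (entry h i j) (entry g i j)

    +M-assoc : ∀ {k} A B C → MatEq q k k ((A +M B) +M C) (A +M (B +M C))
    +M-assoc {k} A B C = matEq λ i j → ≡⇒≡-mod (ℤP.+-assoc (A i j k) (B i j k) (C i j k))

  ·M-cong-scale : ∀ {q k₁ k₂ A B} c → MatEq q k₁ k₂ A B → MatEq (c ℕ.* q) k₁ k₂ (c ·M A) (c ·M B)
  ·M-cong-scale c h = matEq λ i j → *-cong-mod-scale c (entry h i j)

  matEq-weaken : ∀ {q q′ k₁ k₂ A B} → q ℕD.∣ q′ → MatEq q′ k₁ k₂ A B → MatEq q k₁ k₂ A B
  matEq-weaken d h = matEq λ i j → ≡-mod-weaken d (entry h i j)

·M-cong : ∀ {n q k₁ k₂} c {A B : Mat n} → MatEq q k₁ k₂ A B → MatEq q k₁ k₂ (c ·M A) (c ·M B)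
·M-cong c h = matEq λ i j → *-cong-mod (≡-mod-refl {a = + c}) (entry h i j)

·M-zero : ∀ {n q k} c {A : Mat n} → MatZero q k A → MatZero (c ℕ.* q) k (c ·M A)
·M-zero c h = matEq λ i j → ≡-mod-trans (entry (·M-cong-scale c h) i j) (≡⇒≡-mod (ℤP.*-zeroʳ (+ c)))

+M-identityʳ-zero : ∀ {n q k} (A : Mat n) {B} → MatZero q k B → MatEq q k k (A +M B) A
+M-identityʳ-zero {k = k} A h = matEq λ i j →
  ≡-mod-trans (+-cong-mod (≡-mod-refl {a = A i j k}) (entry h i j)) (≡⇒≡-mod (ℤP.+-identityʳ (A i j k)))

module _ {n : ℕ} {q : ℕ} where

  sumUpTo-cong : ∀ {k₁ k₂} (f g : ℕ → Mat n) → (∀ j → MatEq q k₁ k₂ (f j) (g j)) →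
    ∀ l → MatEq q k₁ k₂ (sumUpTo f l) (sumUpTo g l)
  sumUpTo-cong f g h zero    = h zero
  sumUpTo-cong f g h (suc l) = +M-cong (sumUpTo-cong f g h l) (h (suc l))

  sumUpTo-unfoldˡ : ∀ {k} (f : ℕ → Mat n) l →
    MatEq q k k (sumUpTo f (suc l)) (f 0 +M sumUpTo (λ j → f (suc j)) l)
  sumUpTo-unfoldˡ f zero = matEq-refl
  sumUpTo-unfoldˡ {k} f (suc l) = matEq λ i j → ≡-mod-trans
    (+-cong-mod (entry (sumUpTo-unfoldˡ f l) i j) (≡-mod-refl {a = f (suc (suc l)) i j k}))
    (≡⇒≡-mod (ℤP.+-assoc (f 0 i j k) _ _))

  sumUpTo-+M : ∀ {k} (f g : ℕ → Mat n) l →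
    MatEq q k k (sumUpTo (λ j → f j +M g j) l) (sumUpTo f l +M sumUpTo g l)
  sumUpTo-+M f g zero = matEq-refl
  sumUpTo-+M {k} f g (suc l) = matEq λ i j → ≡-mod-trans
    (+-cong-mod (entry (sumUpTo-+M f g l) i j) (≡-mod-refl {a = f (suc l) i j k + g (suc l) i j k}))
    (≡⇒≡-mod (solve (sumUpTo f l i j k) (sumUpTo g l i j k) (f (suc l) i j k) (g (suc l) i j k)))
    where solve : ∀ a b c d → (a + b) + (c + d) ≡ (a + c) + (b + d)
          solve = solve-∀

  sumUpTo-·M : ∀ {k} c (f : ℕ → Mat n) l → MatEq q k k (sumUpTo (λ j → c ·M f j) l) (c ·M sumUpTo f l)
  sumUpTo-·M c f zero = matEq-refl
  sumUpTo-·M {k} c f (suc l) = matEq λ i j → ≡-mod-trans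
    (+-cong-mod (entry (sumUpTo-·M c f l) i j) (≡-mod-refl {a = + c * f (suc l) i j k}))
    (≡⇒≡-mod (sym (ℤP.*-distribˡ-+ (+ c) (sumUpTo f l i j k) (f (suc l) i j k))))

  sumUpTo-zero : ∀ {k} (f : ℕ → Mat n) l → (∀ j → j ≤ l → MatZero q k (f j)) → MatZero q k (sumUpTo f l)
  sumUpTo-zero f zero    h = h 0 z≤n
  sumUpTo-zero f (suc l) h =
    +M-cong (sumUpTo-zero f l (λ j j≤l → h j (ℕP.m≤n⇒m≤1+n j≤l))) (h (suc l) ℕP.≤-refl)

  *S-cong : ∀ {k₁ k₂} {F F′ G G′ : Series n} → (∀ j → MatEq q k₁ k₂ (F j) (F′ j)) →
    (∀ j → MatEq q k₁ k₂ (G j) (G′ j)) → ∀ l → MatEq q k₁ k₂ ((F *S G) l) ((F′ *S G′) l)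
  *S-cong {F = F} {F′} {G} {G′} hF hG l =
    sumUpTo-cong (λ j → F j *M G (l ∸ j)) (λ j → F′ j *M G′ (l ∸ j)) (λ j → *M-cong (hF j) (hG (l ∸ j))) l

  *S-distribˡ-+S : ∀ {k} (F G H : Series n) l → MatEq q k k ((F *S (G +S H)) l) ((F *S G) l +M (F *S H) l)
  *S-distribˡ-+S F G H l = matEq-trans
    (sumUpTo-cong (λ j → F j *M (G +S H) (l ∸ j)) (λ j → (F j *M G (l ∸ j)) +M (F j *M H (l ∸ j)))
                  (λ j → *M-distribˡ-+M (F j) (G (l ∸ j)) (H (l ∸ j))) l)
    (sumUpTo-+M (λ j → F j *M G (l ∸ j)) (λ j → F j *M H (l ∸ j)) l)

  *S-zeroʳ : ∀ {k} (F G : Series n) → (∀ j → MatZero q k (G j)) → ∀ l → MatZero q k ((F *S G) l)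
  *S-zeroʳ F G h l = sumUpTo-zero (λ j → F j *M G (l ∸ j)) l (λ j _ → *M-zeroʳ (F j) (h (l ∸ j)))

  *S-eventually-zero : ∀ {k} (F G : Series n) L₁ L₂ → (∀ j → L₁ ≤ j → MatZero q k (F j)) →
    (∀ j → L₂ ≤ j → MatZero q k (G j)) → ∀ l → L₁ ℕ.+ L₂ ≤ l → MatZero q k ((F *S G) l)
  *S-eventually-zero {k} F G L₁ L₂ hF hG l le = sumUpTo-zero (λ j → F j *M G (l ∸ j)) l term
    where
    term : ∀ j → j ≤ l → MatZero q k (F j *M G (l ∸ j))
    term j _ with L₁ ℕP.≤? j
    ... | yes L₁≤j = *M-zeroˡ (G (l ∸ j)) (hF j L₁≤j)
    ... | no L₁≰j  = *M-zeroʳ (F j) (hG (l ∸ j) (ℕP.m+n≤o⇒m≤o∸n L₂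
           (ℕP.≤-trans (ℕP.+-monoʳ-≤ L₂ (ℕP.<⇒≤ (ℕP.≰⇒> L₁≰j))) (ℕP.≤-trans (ℕP.≤-reflexive (ℕP.+-comm L₂ L₁)) le))))

constS-zero : ∀ {n q k} {A : Mat n} l → 1 ≤ l → MatZero q k (constS A l)
constS-zero (suc l) _ = matEq-refl

module _ (p : ℕ) {n : ℕ} (Y : Mat n) (M : Series n) {q k : ℕ} where

  wpoly-coeff₀ : MatEq q k k (wpoly p Y M 0) Y
  wpoly-coeff₀ = matEq λ i j → ≡⇒≡-mod (solve (Y i j k) (+ p))
    where solve : ∀ a c → a + (+ 0 + c * + 0) ≡ a
          solve = solve-∀

  wpoly-coeff₁ : MatEq q k k (wpoly p Y M 1) IM
  wpoly-coeff₁ = matEq λ i j → ≡⇒≡-mod (solve (IM i j k) (+ p))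
    where solve : ∀ a c → + 0 + (a + c * + 0) ≡ a
          solve = solve-∀

  wpoly-coeff₂₊ : ∀ l → MatEq q k k (wpoly p Y M (suc (suc l))) (p ·M M l)
  wpoly-coeff₂₊ l = matEq λ i j → ≡⇒≡-mod (solve (+ p * M l i j k))
    where solve : ∀ a → + 0 + (+ 0 + a) ≡ a
          solve = solve-∀

  wpoly-*S-coeff₀ : ∀ D → MatEq q k k ((wpoly p Y M *S D) 0) (Y *M D 0)
  wpoly-*S-coeff₀ D = *M-cong wpoly-coeff₀ matEq-refl

  wpoly-*S-coeff₁ : ∀ D → MatEq q k k ((wpoly p Y M *S D) 1) ((Y *M D 1) +M D 0)
  wpoly-*S-coeff₁ D = +M-cong (*M-cong wpoly-coeff₀ matEq-refl)
                               (matEq-trans (*M-cong wpoly-coeff₁ matEq-refl) (*M-identityˡ (D 0)))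

  wpoly-*S-coeff₂₊ : ∀ D l → MatEq q k k ((wpoly p Y M *S D) (suc (suc l)))
                                          ((Y *M D (suc (suc l))) +M (D (suc l) +M (p ·M (M *S D) l)))
  wpoly-*S-coeff₂₊ D l =
    matEq-trans (sumUpTo-unfoldˡ term (suc l))
      (+M-cong (*M-cong wpoly-coeff₀ matEq-refl)
        (matEq-trans (sumUpTo-unfoldˡ (λ j → term (suc j)) l)
          (+M-cong (matEq-trans (*M-cong wpoly-coeff₁ matEq-refl) (*M-identityˡ (D (suc l))))
            (matEq-trans
              (sumUpTo-cong (λ j → term (suc (suc j))) (λ j → p ·M (M j *M D (l ∸ j)))
                (λ j → matEq-trans (*M-cong (wpoly-coeff₂₊ j) matEq-refl) (·M-*M-assoc p (M j) (D (l ∸ j)))) l)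
              (sumUpTo-·M p (λ j → M j *M D (l ∸ j)) l)))))
    where
    term : ℕ → Mat n
    term j = wpoly p Y M j *M D (suc (suc l) ∸ j)

  wpoly-eventually-zero : ∀ L → (∀ j → L ≤ j → MatZero q k (M j)) →
    ∀ j → 2 ℕ.+ L ≤ j → MatZero q k (wpoly p Y M j)
  wpoly-eventually-zero L h (suc (suc j)) (s≤s (s≤s L≤j)) = matEq-trans (wpoly-coeff₂₊ j)
    (matEq λ i i′ → ≡-mod-trans (*-cong-mod (≡-mod-refl {a = + p}) (entry (h j L≤j) i i′))
                                (≡⇒≡-mod (ℤP.*-zeroʳ (+ p))))

wpoly-suc-cong : ∀ p {n} (Y : Mat n) {N : Series n} {q k₁ k₂} → (∀ j → MatEq q k₁ k₂ (N j) (N j)) →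
  ∀ l → MatEq q k₁ k₂ (wpoly p Y N (suc l)) (wpoly p Y N (suc l))
wpoly-suc-cong p Y {N} {k₁ = k₁} {k₂} h zero = matEq-trans (wpoly-coeff₁ p Y N)
  (matEq-trans (matEq λ i j → ≡⇒≡-mod (IM-level i j k₁ k₂)) (matEq-sym (wpoly-coeff₁ p Y N)))
wpoly-suc-cong p Y {N} h (suc l) = matEq-trans (wpoly-coeff₂₊ p Y N l)
  (matEq-trans (·M-cong p (h l)) (matEq-sym (wpoly-coeff₂₊ p Y N l)))

wpoly-*S-suc : ∀ p {n} (X : Mat n) (M : Series n) e {k} (D G : Series n) →
  (∀ l → MatEq (p ^ suc e) k k ((X *M D (suc l)) +M D l) (G l)) → (∀ l → MatZero (p ^ e) k (D l)) →
  ∀ l → MatEq (p ^ suc e) k k ((wpoly p X M *S D) (suc l)) (G l)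
wpoly-*S-suc p X M e D G rec D≡0 zero = matEq-trans (wpoly-*S-coeff₁ p X M D) (rec 0)
wpoly-*S-suc p X M e D G rec D≡0 (suc l) =
  matEq-trans (wpoly-*S-coeff₂₊ p X M D l)
    (matEq-trans (matEq-sym (+M-assoc (X *M D (suc (suc l))) (D (suc l)) (p ·M (M *S D) l)))
      (matEq-trans (+M-identityʳ-zero _ (·M-zero p (*S-zeroʳ M D D≡0 l))) (rec (suc l))))

-- Modulo p^(e+1), the term p (M U) in degree l + 2 of (X + I t + p t² M) U only depends on U modulo
-- p^e, so the positive coefficients of the product determine X U_{l+1} + U_l; by descending induction from the vanishing
-- tail this determines every U_l.
wpoly-*S-cancelˡ : ∀ (p : ℕ) {n} (X : Mat n) (M : Series n) e {k₁ k₂} (U U′ : Series n) L₁ L₂ →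
  MatEq (p ^ e) k₁ k₂ X X →
  (∀ j → MatEq (p ^ e) k₁ k₂ (M j) (M j)) →
  (∀ l → L₁ ≤ l → MatZero (p ^ e) k₁ (U l)) →
  (∀ l → L₂ ≤ l → MatZero (p ^ e) k₂ (U′ l)) →
  (∀ l → MatEq (p ^ e) k₁ k₂ ((wpoly p X M *S U) (suc l)) ((wpoly p X M *S U′) (suc l))) →
  ∀ l → MatEq (p ^ e) k₁ k₂ (U l) (U′ l)
wpoly-*S-cancelˡ p X M zero U U′ L₁ L₂ hX hM h₁ h₂ hyp l = matEq λ i j → ≡-mod-1
wpoly-*S-cancelˡ p X M (suc e) {k₁} {k₂} U U′ L₁ L₂ hX hM h₁ h₂ hyp l =
  descend (L₁ ℕ.+ L₂) l (ℕP.m≤n+m (L₁ ℕ.+ L₂) l)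
  where
  weaken : ∀ {k₁ k₂ A B} → MatEq (p ^ suc e) k₁ k₂ A B → MatEq (p ^ e) k₁ k₂ A B
  weaken = matEq-weaken (^-monoʳ-∣ p (ℕP.n≤1+n e))

  U≡U′-mod-p^e : ∀ l → MatEq (p ^ e) k₁ k₂ (U l) (U′ l)
  U≡U′-mod-p^e = wpoly-*S-cancelˡ p X M e U U′ L₁ L₂ (weaken hX) (λ j → weaken (hM j))
    (λ l le → weaken (h₁ l le)) (λ l le → weaken (h₂ l le)) (λ l → weaken (hyp l))

  recurrence : ∀ l → MatEq (p ^ suc e) k₁ k₂ ((X *M U (suc l)) +M U l) ((X *M U′ (suc l)) +M U′ l)
  recurrence zero = matEq-trans (matEq-sym (wpoly-*S-coeff₁ p X M U))
                                (matEq-trans (hyp 0) (wpoly-*S-coeff₁ p X M U′))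
  recurrence (suc l) = +M-cancelʳ
    (matEq-trans (+M-assoc (X *M U (suc (suc l))) (U (suc l)) (p ·M (M *S U) l))
      (matEq-trans (matEq-sym (wpoly-*S-coeff₂₊ p X M U l))
        (matEq-trans (hyp (suc l)) (matEq-trans (wpoly-*S-coeff₂₊ p X M U′ l)
          (matEq-sym (+M-assoc (X *M U′ (suc (suc l))) (U′ (suc l)) (p ·M (M *S U′) l)))))))
    (·M-cong-scale p (*S-cong (λ j → weaken (hM j)) U≡U′-mod-p^e l))

  descend : ∀ d l → L₁ ℕ.+ L₂ ≤ l ℕ.+ d → MatEq (p ^ suc e) k₁ k₂ (U l) (U′ l)
  descend zero l le = matZero-matEq (h₁ l (ℕP.m+n≤o⇒m≤o L₁ le′)) (h₂ l (ℕP.m+n≤o⇒n≤o L₁ le′))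
    where
    le′ : L₁ ℕ.+ L₂ ≤ l
    le′ = subst (L₁ ℕ.+ L₂ ≤_) (ℕP.+-identityʳ l) le
  descend (suc d) l le =
    +M-cancelˡ (recurrence l) (*M-cong hX (descend d (suc l) (subst (L₁ ℕ.+ L₂ ≤_) (ℕP.+-suc l d) le)))

_-M_ : ∀ {n} → Mat n → Mat n → Mat n
(A -M B) i j k = A i j k - B i j k

-- Solving X D_{l+1} + D_l = G_l for a G vanishing from degree L on: D_l = G_l - X D_{l+1} unrolled
-- L + 1 times, which is enough since unrolling further does not change anything.
module BackSubstitution {n : ℕ} (X : Mat n) (G : Series n) {q k : ℕ} (L : ℕ)
                        (G-zero : ∀ l → L ≤ l → MatZero q k (G l)) where

  unroll : ℕ → ℕ → Mat n
  unroll l zero    = 0M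
  unroll l (suc f) = G l -M (X *M unroll (suc l) f)

  unroll-zero : ∀ {q′} L′ → (∀ l → L′ ≤ l → MatZero q′ k (G l)) → ∀ f l → L′ ≤ l → MatZero q′ k (unroll l f)
  unroll-zero L′ h zero    l le = matEq-refl
  unroll-zero L′ h (suc f) l le = matEq λ i j →
    sub-cong-mod (entry (h l le) i j) (entry (*M-zeroʳ X (unroll-zero L′ h f (suc l) (ℕP.m≤n⇒m≤1+n le))) i j)

  unroll-stable : ∀ f l → L ≤ l ℕ.+ f → MatEq q k k (unroll l (suc f)) (unroll l f)
  unroll-stable zero l le =
    unroll-zero L G-zero 1 l (subst (L ≤_) (ℕP.+-identityʳ l) le)
  unroll-stable (suc f) l le = matEq λ i j →
    sub-cong-mod (≡-mod-refl {a = G l i j k})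
      (entry (*M-cong (matEq-refl {A = X}) (unroll-stable f (suc l) (subst (L ≤_) (ℕP.+-suc l f) le))) i j)

  D : Series n
  D l = unroll l (suc L)

  D-recurrence : ∀ l → MatEq q k k ((X *M D (suc l)) +M D l) (G l)
  D-recurrence l = matEq λ i j → ≡-mod-trans
    (+-cong-mod (entry (*M-cong (matEq-refl {A = X}) (unroll-stable L (suc l) (ℕP.m≤n+m L (suc l)))) i j)
                (≡-mod-refl {a = D l i j k}))
    (≡⇒≡-mod (+-sub-cancel ((X *M unroll (suc l) L) i j k) (G l i j k)))

  D-eventually-zero : ∀ l → L ≤ l → MatZero q k (D l)
  D-eventually-zero = unroll-zero L G-zero (suc L)

  D-zero : ∀ {q′} → (∀ l → MatZero q′ k (G l)) → ∀ l → MatZero q′ k (D l)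
  D-zero h l = unroll-zero 0 (λ l _ → h l) (suc L) l z≤n

module LevelwiseSolution (p : ℕ) {n : ℕ} (X : Mat n) (M N : Series n) (k LM LN : ℕ)
  (M-zero : ∀ j → LM ≤ j → MatZero (p ^ k) k (M j))
  (N-zero : ∀ j → LN ≤ j → MatZero (p ^ k) k (N j)) where

  W : Series n
  W = wpoly p X M

  -- Only the positive-degree coefficients are matched; they do not depend on the constant term,
  -- here taken to be 0M.
  record Approximation (e : ℕ) : Set where
    field
      U       : Series n
      support : ℕ
      U-zero  : ∀ l → support ≤ l → MatZero (p ^ k) k (U l)
      solves  : ∀ l → MatEq (p ^ e) k k ((W *S U) (suc l)) (wpoly p 0M N (suc l))

  initial : Approximation 0
  initial = record { U = constS IM ; support = 1 ; U-zero = constS-zero ; solves = λ l → matEq λ i j → ≡-mod-1 }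

  refine : ∀ {e} → suc e ≤ k → Approximation e → Approximation (suc e)
  refine {e} e<k a = record { U = U +S D ; support = L ; U-zero = U+D-zero ; solves = solves′ }
    where
    open Approximation a

    G : Series n
    G l = wpoly p 0M N (suc l) -M (W *S U) (suc l)

    L : ℕ
    L = ((2 ℕ.+ LM) ℕ.+ support) ℕ.+ (2 ℕ.+ LN)

    G-zero : ∀ l → L ≤ l → MatZero (p ^ k) k (G l)
    G-zero l le = matEq λ i j → sub-cong-mod
      (entry (wpoly-eventually-zero p 0M N LN N-zero (suc l)
        (ℕP.m≤n⇒m≤1+n (ℕP.m+n≤o⇒n≤o ((2 ℕ.+ LM) ℕ.+ support) le))) i j)
      (entry (*S-eventually-zero W U (2 ℕ.+ LM) support (wpoly-eventually-zero p X M LM M-zero) U-zero (suc l)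
        (ℕP.m≤n⇒m≤1+n (ℕP.m+n≤o⇒m≤o ((2 ℕ.+ LM) ℕ.+ support) le))) i j)

    G-small : ∀ l → MatZero (p ^ e) k (G l)
    G-small l = matEq λ i j → ≡-mod-trans (sub-cong-mod (≡-mod-sym (entry (solves l) i j)) ≡-mod-refl)
                                          (≡⇒≡-mod (ℤP.+-inverseʳ ((W *S U) (suc l) i j k)))

    open BackSubstitution X G L G-zero

    U+D-zero : ∀ l → L ≤ l → MatZero (p ^ k) k ((U +S D) l)
    U+D-zero l le = +M-cong
      (U-zero l (ℕP.≤-trans (ℕP.m≤n+m support (2 ℕ.+ LM)) (ℕP.m+n≤o⇒m≤o ((2 ℕ.+ LM) ℕ.+ support) le)))
      (D-eventually-zero l le)

    solves′ : ∀ l → MatEq (p ^ suc e) k k ((W *S (U +S D)) (suc l)) (wpoly p 0M N (suc l))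
    solves′ l = matEq-trans (*S-distribˡ-+S W U D (suc l))
      (matEq-trans
        (+M-cong (matEq-refl {A = (W *S U) (suc l)})
          (wpoly-*S-suc p X M e D G (λ l → matEq-weaken (^-monoʳ-∣ p e<k) (D-recurrence l)) (D-zero G-small) l))
        (matEq λ i j → ≡⇒≡-mod (+-sub-cancel ((W *S U) (suc l) i j k) (wpoly p 0M N (suc l) i j k))))

  approximation : ∀ e → e ≤ k → Approximation e
  approximation zero    _   = initial
  approximation (suc e) e<k = refine e<k (approximation e (ℕP.≤-trans (ℕP.n≤1+n e) e<k))

  solution : Approximation k
  solution = approximation k ℕP.≤-refl

constS-IM-isMat : ∀ {p n} l → IsMat p n (constS IM l)
constS-IM-isMat zero    i j k = ≡-mod⇒[mod] (≡⇒≡-mod (IM-level i j (suc k) k))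
constS-IM-isMat (suc l) i j k = ≡-mod⇒[mod] (≡-mod-refl {a = + 0})

isZp-step : ∀ {p} x → IsZp p x → ∀ k → x (suc k) ≡ x k ⟨mod p ^ k ⟩
isZp-step x h k = [mod]⇒≡-mod (h k)

module _ {p n : ℕ} where

  isMat⇒coherent : ∀ {X : Mat n} → IsMat p n X → ∀ k → MatEq (p ^ k) (suc k) k X X
  isMat⇒coherent h k = matEq λ i j → [mod]⇒≡-mod (h i j k)

  coherent⇒isMat : ∀ {X : Mat n} → (∀ k → MatEq (p ^ k) (suc k) k X X) → IsMat p n X
  coherent⇒isMat h i j k = ≡-mod⇒[mod] (entry (h k) i j)

  module _ (C : Series n) (h : IsRestricted p n C) where

    restricted⇒coherent : ∀ k j → MatEq (p ^ k) (suc k) k (C j) (C j)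
    restricted⇒coherent k j = isMat⇒coherent (proj₁ h j) k

    support : ℕ → ℕ
    support k = proj₁ (proj₂ h k)

    support-zero : ∀ k j → support k ≤ j → MatZero (p ^ k) k (C j)
    support-zero k j le = matEq λ i i′ → [mod]⇒≡-mod (proj₂ (proj₂ h k) j le i i′)

-- The quotient is taken one level up: (a_{k+1} - b_{k+1}) / p is exact modulo p^k.
module Divide (p : ℕ) .{{_ : ℕ.NonZero p}} (a b : Zs) (a≡b : ∀ k → a (suc k) ≡ b (suc k) ⟨mod p ⟩) where

  divide : Zs
  divide k = S._∣_.quotient (divides-diff (a≡b k))

  *-divide : ∀ k → + p * divide k ≡ a (suc k) - b (suc k)
  *-divide k = trans (ℤP.*-comm (+ p) (divide k)) (sym (S._∣_.equality (divides-diff (a≡b k))))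

  divide-isZp : IsZp p a → IsZp p b → IsZp p divide
  divide-isZp ha hb k = ≡-mod⇒[mod] (*-cancel-mod-scale p
    (≡-mod-trans (≡⇒≡-mod (*-divide (suc k)))
      (≡-mod-trans (sub-cong-mod (isZp-step a ha (suc k)) (isZp-step b hb (suc k)))
                   (≡⇒≡-mod (sym (*-divide k))))))

  divide-zero : ∀ k → a (suc k) ≡ b (suc k) ⟨mod p ^ suc k ⟩ → divide k ≡ + 0 ⟨mod p ^ k ⟩
  divide-zero k h = *-cancel-mod-scale p
    (≡-mod-trans (≡⇒≡-mod (*-divide k))
      (≡-mod-trans (sub-cong-mod h (≡-mod-refl {a = b (suc k)}))
                   (≡⇒≡-mod (trans (ℤP.+-inverseʳ (b (suc k))) (sym (ℤP.*-zeroʳ (+ p)))))))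

  ≈-+-divide : IsZp p a → IsZp p b → a ≈[ p ] (b +s (zsNat p *s divide))
  ≈-+-divide ha hb k = ≡-mod⇒[mod]
    (≡-mod-trans (≡-mod-sym (isZp-step a ha k))
      (≡-mod-trans (≡⇒≡-mod (trans (sym (+-sub-cancel (b (suc k)) (a (suc k)))) (cong (λ z → b (suc k) + z) (sym (*-divide k)))))
                   (+-cong-mod (isZp-step b hb k) (≡-mod-refl {a = + p * divide k}))))

module Solution (p : ℕ) {n : ℕ} (p-prime : Prime p) (M N : Series n)
  (M-restricted : IsRestricted p n M) (N-restricted : IsRestricted p n N) (X : Mat n) (X-mat : IsMat p n X) where

  instance
    p≢0 : ℕ.NonZero p
    p≢0 = prime⇒nonZero p-prime

  W : Series n
  W = wpoly p X M

  level : ∀ k → LevelwiseSolution.Approximation p X M N k (support M M-restricted k) (support N N-restricted k)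
                  (support-zero M M-restricted k) (support-zero N N-restricted k) k
  level k = LevelwiseSolution.solution p X M N k _ _ (support-zero M M-restricted k) (support-zero N N-restricted k)

  open LevelwiseSolution.Approximation using () renaming (U to Uₖ; support to supportₖ)

  U : Series n
  U l i j k = Uₖ (level k) l i j k

  U-zero : ∀ k l → supportₖ (level k) ≤ l → MatZero (p ^ k) k (U l)
  U-zero k l le = matEq (entry (LevelwiseSolution.Approximation.U-zero (level k) l le))

  U-solves : ∀ k l → MatEq (p ^ k) k k ((W *S U) (suc l)) (wpoly p 0M N (suc l))
  U-solves k l = matEq-trans (*S-cong {F = W} {W} {U} {Uₖ (level k)} (λ _ → matEq-refl) (λ _ → matEq λ i j → ≡-mod-refl) (suc l))
                             (LevelwiseSolution.Approximation.solves (level k) l)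

  U-coherent : ∀ k l → MatEq (p ^ k) (suc k) k (U l) (U l)
  U-coherent k = wpoly-*S-cancelˡ p X M k U U (supportₖ (level (suc k))) (supportₖ (level k))
    (isMat⇒coherent X-mat k) (restricted⇒coherent M M-restricted k)
    (λ l le → matEq-weaken p^k∣p^1+k (U-zero (suc k) l le)) (U-zero k)
    (λ l → matEq-trans (matEq-weaken p^k∣p^1+k (U-solves (suc k) l))
             (matEq-trans (wpoly-suc-cong p 0M (restricted⇒coherent N N-restricted k) l) (matEq-sym (U-solves k l))))
    where
    p^k∣p^1+k : (p ^ k) ℕD.∣ (p ^ suc k)
    p^k∣p^1+k = ^-monoʳ-∣ p (ℕP.n≤1+n k)

  -- I solves the positive-degree equations modulo p, so this is uniqueness modulo p.
  U≡I-mod-p : ∀ k l → MatEq p (suc k) (suc k) (U l) (constS IM l)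
  U≡I-mod-p k l = matEq-weaken (ℕD.m∣m*n 1)
    (wpoly-*S-cancelˡ p X M 1 U (constS IM) (supportₖ (level (suc k))) 1 matEq-refl (λ _ → matEq-refl)
      (λ l le → matEq-weaken p∣p^1+k (U-zero (suc k) l le)) constS-zero
      (λ l → matEq-trans (matEq-weaken p∣p^1+k (U-solves (suc k) l)) (matEq-sym (I-solves l))) l)
    where
    p∣p^1+k : (p ^ 1) ℕD.∣ (p ^ suc k)
    p∣p^1+k = ^-monoʳ-∣ p {1} {suc k} (s≤s z≤n)

    I-recurrence : ∀ l → MatEq (p ^ 1) (suc k) (suc k) ((X *M constS IM (suc l)) +M constS IM l) (wpoly p 0M N (suc l))
    I-recurrence zero = +M-cong (*M-zeroʳ X matEq-refl)
      (matEq-sym (+M-identityʳ-zero IM (matEq λ i j → ≡⇒≡-mod (ℤP.*-zeroʳ (+ p)))))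
    I-recurrence (suc l) = +M-cong (*M-zeroʳ X matEq-refl)
      (matEq-sym (+M-cong (matEq-refl {A = 0M}) (·M-zero p {A = N l} (matEq λ i j → ≡-mod-1))))

    I-solves : ∀ l → MatEq (p ^ 1) (suc k) (suc k) ((W *S constS IM) (suc l)) (wpoly p 0M N (suc l))
    I-solves = wpoly-*S-suc p X M 0 (constS IM) (λ l → wpoly p 0M N (suc l)) I-recurrence (λ _ → matEq λ i j → ≡-mod-1)

  X′ : Mat n
  X′ = (W *S U) 0

  X′-coherent : ∀ k → MatEq (p ^ k) (suc k) k X′ X′
  X′-coherent k = matEq-trans (wpoly-*S-coeff₀ p X M U)
    (matEq-trans (*M-cong (isMat⇒coherent {X = X} X-mat k) (U-coherent k 0)) (matEq-sym (wpoly-*S-coeff₀ p X M U)))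

  X′≡X-mod-p : ∀ k → MatEq p (suc k) (suc k) X′ X
  X′≡X-mod-p k = matEq-trans (wpoly-*S-coeff₀ p X M U)
    (matEq-trans (*M-cong (matEq-refl {A = X}) (U≡I-mod-p k 0)) (*M-identityʳ X))

  U-restricted : IsRestricted p n U
  U-restricted = (λ l → coherent⇒isMat (λ k → U-coherent k l))
               , λ k → supportₖ (level k) , λ l le i j → ≡-mod⇒[mod] (entry (U-zero k l le) i j)

  X′-mat : IsMat p n X′
  X′-mat = coherent⇒isMat X′-coherent

  solves : (W *S U) ≈S[ p ] wpoly p X′ N
  solves zero    i j k = ≡-mod⇒[mod] (entry (matEq-sym (wpoly-coeff₀ p X′ N)) i j)
  solves (suc l) i j k = ≡-mod⇒[mod] (entry (U-solves k l) i j)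

  unique : ∀ (U₂ : Series n) (X₂ : Mat n) → IsRestricted p n U₂ → IsMat p n X₂ →
    ((W *S U₂) ≈S[ p ] wpoly p X₂ N) → (U₂ ≈S[ p ] U) × (X₂ ≈M[ p ] X′)
  unique U₂ X₂ U₂-restricted _ eq₂ = (λ l i j k → ≡-mod⇒[mod] (entry (U₂≡U k l) i j))
                                   , λ i j k → ≡-mod⇒[mod] (entry (X₂≡X′ k) i j)
    where
    eq₂-at : ∀ k l → MatEq (p ^ k) k k ((W *S U₂) l) (wpoly p X₂ N l)
    eq₂-at k l = matEq λ i j → [mod]⇒≡-mod (eq₂ l i j k)

    U₂≡U : ∀ k l → MatEq (p ^ k) k k (U₂ l) (U l)
    U₂≡U k = wpoly-*S-cancelˡ p X M k U₂ U (support U₂ U₂-restricted k) (supportₖ (level k))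
      matEq-refl (λ _ → matEq-refl) (support-zero U₂ U₂-restricted k) (U-zero k)
      (λ l → matEq-trans (eq₂-at k (suc l)) (matEq-sym (U-solves k l)))

    X₂≡X′ : ∀ k → MatEq (p ^ k) k k X₂ X′
    X₂≡X′ k = matEq-trans (matEq-sym (wpoly-coeff₀ p X₂ N))
      (matEq-trans (matEq-sym (eq₂-at k 0))
        (matEq-trans (wpoly-*S-coeff₀ p X M U₂)
          (matEq-trans (*M-cong (matEq-refl {A = X}) (U₂≡U k 0)) (matEq-sym (wpoly-*S-coeff₀ p X M U)))))

  module U-I (l : ℕ) (i j : Fin n) = Divide p (U l i j) (constS IM l i j) (λ k → entry (U≡I-mod-p k l) i j)
  module X′-X (i j : Fin n) = Divide p (X′ i j) (X i j) (λ k → entry (X′≡X-mod-p k) i j)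

  V : Series n
  V l i j = U-I.divide l i j

  V-restricted : IsRestricted p n V
  V-restricted =
      (λ l i j → U-I.divide-isZp l i j (proj₁ U-restricted l i j) (constS-IM-isMat l i j))
    , λ k → suc (supportₖ (level (suc k))) , V-zero k
    where
    V-zero : ∀ k l → suc (supportₖ (level (suc k))) ≤ l → ∀ i j → V l i j k ≡ + 0 [mod p ^ k ]
    V-zero k (suc l) (s≤s le) i j = ≡-mod⇒[mod] (U-I.divide-zero (suc l) i j k
      (entry (U-zero (suc k) (suc l) (ℕP.m≤n⇒m≤1+n le)) i j))

  U≈I+pV : U ≈S[ p ] (constS IM +S (p ·S V))
  U≈I+pV l i j = U-I.≈-+-divide l i j (proj₁ U-restricted l i j) (constS-IM-isMat l i j)

  Y : Mat n
  Y i j = X′-X.divide i j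

  Y-mat : IsMat p n Y
  Y-mat i j = X′-X.divide-isZp i j (X′-mat i j) (X-mat i j)

  X′≈X+pY : X′ ≈M[ p ] (X +M (p ·M Y))
  X′≈X+pY i j = X′-X.≈-+-divide i j (X′-mat i j) (X-mat i j)

theorem5p5 : (p n : ℕ) → Prime p → 1 ≤ n →
    (M N : Series n) → IsRestricted p n M → IsRestricted p n N →
    (X : Mat n) → IsMat p n X →
    Σ (Series n) λ U → Σ (Mat n) λ X′ →
      ((IsRestricted p n U × IsMat p n X′ ×
        ((wpoly p X M *S U) ≈S[ p ] wpoly p X′ N)) ×
       (∀ (U₂ : Series n) (X₂ : Mat n) → IsRestricted p n U₂ → IsMat p n X₂ →
          ((wpoly p X M *S U₂) ≈S[ p ] wpoly p X₂ N) →
          (U₂ ≈S[ p ] U) × (X₂ ≈M[ p ] X′))) ×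
      (Σ (Series n) λ V → IsRestricted p n V × (U ≈S[ p ] (constS IM +S (p ·S V)))) ×
      (Σ (Mat n) λ Y → IsMat p n Y × (X′ ≈M[ p ] (X +M (p ·M Y))))
theorem5p5 p n p-prime _ M N M-restricted N-restricted X X-mat =
    U , X′ , ((U-restricted , X′-mat , solves) , unique)
  , (V , V-restricted , U≈I+pV)
  , (Y , Y-mat , X′≈X+pY)
  where open Solution p p-prime M N M-restricted N-restricted X X-mat
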